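{- Let $\mathbf B$ be a Boolean-pointed Brouwerian algebra with constant $0$, and write $\neg a:=a\to 0$. For all $a,b\in B$, if $0\wedge a=0\wedge b$ and $\neg a=\neg b$, then $a=b$.
   Context: A Brouwerian algebra is a distributive lattice with top element $1$ equipped with a binary operation $\to$ of relative pseudocomplementation: $c\le a\to b\iff c\wedge a\le b$. It is Boolean-pointed if it has a constant $0$ such that the interval $[0,1]$ is a Boolean lattice (equivalently, $\neg\neg x=x\vee 0$ for all $x$, where $\neg x=x\to 0$). -}

module Defs where

open import Level using (Level; suc; _⊔_)
open import Data.Product using (Σ; _×_)
open import Relation.Binary.Core using (Rel)
open import Relation.Binary.Definitions using (Maximum)
open import Relation.Binary.Lattice.Definitions using (Exponential)
open import Relation.Binary.Lattice.Structures using (IsDistributiveLattice)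
open import Algebra.Core using (Op₂)

-- No bottom element is required.
record BrouwerianAlgebra c ℓ₁ ℓ₂ : Set (suc (c ⊔ ℓ₁ ⊔ ℓ₂)) where
  infix  4 _≈_ _≤_
  infixr 5 _⇨_
  infixr 6 _∨_
  infixr 7 _∧_
  field
    Carrier               : Set c
    _≈_                   : Rel Carrier ℓ₁
    _≤_                   : Rel Carrier ℓ₂
    _∨_                   : Op₂ Carrier
    _∧_                   : Op₂ Carrier
    _⇨_                   : Op₂ Carrier
    ⊤                     : Carrier
    isDistributiveLattice : IsDistributiveLattice _≈_ _≤_ _∨_ _∧_
    maximum               : Maximum _≤_ ⊤
    exponential           : Exponential _≤_ _∧_ _⇨_

  open IsDistributiveLattice isDistributiveLattice public

-- A Boolean-pointed Brouwerian algebra: a Brouwerian algebra with a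
-- constant 𝟘 such that the interval [𝟘, ⊤] is a Boolean lattice, i.e.
-- every element x of the interval has a complement y in the interval
-- (x ∧ y ≈ 𝟘 and x ∨ y ≈ ⊤).  The interval is automatically a bounded
-- distributive sublattice, so complementedness is exactly Booleanness.
record BooleanPointedBrouwerianAlgebra c ℓ₁ ℓ₂ : Set (suc (c ⊔ ℓ₁ ⊔ ℓ₂)) where
  field
    brouwerianAlgebra : BrouwerianAlgebra c ℓ₁ ℓ₂

  open BrouwerianAlgebra brouwerianAlgebra public

  field
    𝟘           : Carrier
    complemented : ∀ x → 𝟘 ≤ x →
                   Σ Carrier (λ y → (𝟘 ≤ y) × ((x ∧ y ≈ 𝟘) × (x ∨ y ≈ ⊤)))

  ¬_ : Carrier → Carrier
  ¬ x = x ⇨ 𝟘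

{-# OPTIONS --safe #-}
-- Let z be the complement of b ∨ 𝟘 in the Boolean interval [𝟘, ⊤].  Since
-- z ∧ b ≤ z ∧ (b ∨ 𝟘) ≈ 𝟘 we get z ≤ ¬ b ≈ ¬ a, hence a ∧ z ≤ 𝟘; as
-- a ≤ ⊤ ≈ (b ∨ 𝟘) ∨ z, distributivity yields a ≤ b ∨ 𝟘 (that is, a ≤ ¬ ¬ b).
-- The same distributivity step, now with a ∧ 𝟘 ≈ 𝟘 ∧ b ≤ b, yields a ≤ b,
-- and the hypotheses are symmetric in a and b.
module Submission where

open import Defs
open import Level using (Level)
open import Data.Product using (_,_)
open import Relation.Binary.Lattice.Bundles using (DistributiveLattice)
import Relation.Binary.Lattice.Properties.MeetSemilattice as MeetSemilatticeProperties
import Relation.Binary.Reasoning.PartialOrder as ≤-Reasoning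

module DistributiveLatticeProperties {c ℓ₁ ℓ₂} (L : DistributiveLattice c ℓ₁ ℓ₂) where
  open DistributiveLattice L
  open ≤-Reasoning poset

  x≤y∨z⇒x∧z≤y⇒x≤y : ∀ {x y z} → x ≤ y ∨ z → x ∧ z ≤ y → x ≤ y
  x≤y∨z⇒x∧z≤y⇒x≤y {x} {y} {z} x≤y∨z x∧z≤y = begin
    x              ≤⟨ ∧-greatest refl x≤y∨z ⟩
    x ∧ (y ∨ z)    ≈⟨ ∧-distribˡ-∨ x y z ⟩
    x ∧ y ∨ x ∧ z  ≤⟨ ∨-least (x∧y≤y x y) x∧z≤y ⟩
    y              ∎

module BrouwerianAlgebraProperties {c ℓ₁ ℓ₂} (A : BrouwerianAlgebra c ℓ₁ ℓ₂) where
  open BrouwerianAlgebra A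

  distributiveLattice : DistributiveLattice c ℓ₁ ℓ₂
  distributiveLattice = record { isDistributiveLattice = isDistributiveLattice }

  transpose-⇨ : ∀ {w x y} → w ∧ x ≤ y → w ≤ x ⇨ y
  transpose-⇨ {w} {x} {y} = let pf , _ = exponential w x y in pf

  transpose-∧ : ∀ {w x y} → w ≤ x ⇨ y → w ∧ x ≤ y
  transpose-∧ {w} {x} {y} = let _ , pf = exponential w x y in pf

module BooleanPointedBrouwerianAlgebraProperties
  {c ℓ₁ ℓ₂} (B : BooleanPointedBrouwerianAlgebra c ℓ₁ ℓ₂) where
  open BooleanPointedBrouwerianAlgebra B
  open BrouwerianAlgebraProperties brouwerianAlgebra
  open DistributiveLatticeProperties distributiveLattice
  open DistributiveLattice distributiveLattice using (meetSemilattice; poset)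
  open MeetSemilatticeProperties meetSemilattice using (∧-comm; ∧-monotonic)
  open ≤-Reasoning poset

  ¬y≤¬x⇒x≤y∨𝟘 : ∀ {x y} → ¬ y ≤ ¬ x → x ≤ y ∨ 𝟘
  ¬y≤¬x⇒x≤y∨𝟘 {x} {y} ¬y≤¬x with complemented (y ∨ 𝟘) (y≤x∨y y 𝟘)
  ... | z , _ , y∨𝟘∧z≈𝟘 , y∨𝟘∨z≈⊤ = x≤y∨z⇒x∧z≤y⇒x≤y x≤y∨𝟘∨z x∧z≤y∨𝟘
    where
    z≤¬y : z ≤ ¬ y
    z≤¬y = transpose-⇨ (begin
      z ∧ y        ≤⟨ ∧-monotonic refl (x≤x∨y y 𝟘) ⟩
      z ∧ (y ∨ 𝟘)  ≈⟨ ∧-comm z (y ∨ 𝟘) ⟩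
      (y ∨ 𝟘) ∧ z  ≈⟨ y∨𝟘∧z≈𝟘 ⟩
      𝟘            ∎)

    x∧z≤y∨𝟘 : x ∧ z ≤ y ∨ 𝟘
    x∧z≤y∨𝟘 = begin
      x ∧ z  ≈⟨ ∧-comm x z ⟩
      z ∧ x  ≤⟨ transpose-∧ (trans z≤¬y ¬y≤¬x) ⟩
      𝟘      ≤⟨ y≤x∨y y 𝟘 ⟩
      y ∨ 𝟘  ∎

    x≤y∨𝟘∨z : x ≤ (y ∨ 𝟘) ∨ z
    x≤y∨𝟘∨z = begin
      x            ≤⟨ maximum x ⟩
      ⊤            ≈⟨ Eq.sym y∨𝟘∨z≈⊤ ⟩
      (y ∨ 𝟘) ∨ z  ∎

  ¬y≤¬x⇒𝟘∧x≤𝟘∧y⇒x≤y : ∀ {x y} → ¬ y ≤ ¬ x → 𝟘 ∧ x ≤ 𝟘 ∧ y → x ≤ y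
  ¬y≤¬x⇒𝟘∧x≤𝟘∧y⇒x≤y {x} {y} ¬y≤¬x 𝟘∧x≤𝟘∧y =
    x≤y∨z⇒x∧z≤y⇒x≤y (¬y≤¬x⇒x≤y∨𝟘 ¬y≤¬x) (begin
      x ∧ 𝟘  ≈⟨ ∧-comm x 𝟘 ⟩
      𝟘 ∧ x  ≤⟨ 𝟘∧x≤𝟘∧y ⟩
      𝟘 ∧ y  ≤⟨ x∧y≤y 𝟘 y ⟩
      y      ∎)

mainTheorem15 : ∀ {c ℓ₁ ℓ₂ : Level} (B : BooleanPointedBrouwerianAlgebra c ℓ₁ ℓ₂) →
    let open BooleanPointedBrouwerianAlgebra B in
    ∀ a b → (𝟘 ∧ a) ≈ (𝟘 ∧ b) → (¬ a) ≈ (¬ b) → a ≈ b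
mainTheorem15 B a b 𝟘∧a≈𝟘∧b ¬a≈¬b = antisym
  (¬y≤¬x⇒𝟘∧x≤𝟘∧y⇒x≤y (reflexive (Eq.sym ¬a≈¬b)) (reflexive 𝟘∧a≈𝟘∧b))
  (¬y≤¬x⇒𝟘∧x≤𝟘∧y⇒x≤y (reflexive ¬a≈¬b) (reflexive (Eq.sym 𝟘∧a≈𝟘∧b)))
  where
  open BooleanPointedBrouwerianAlgebra B
  open BooleanPointedBrouwerianAlgebraProperties B
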